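{- Let $n\geq 3$ and $\pi=\pi_1\cdots\pi_n\in\mathcal{S}_n$. Then [$\pi$ avoids both $231$ and $1432$, $\pi^2$ avoids $231$, and $\pi_n=n$] if and only if $\pi=\sigma\oplus 1$ for some $\sigma\in\mathcal{S}_{n-1}$ such that $\sigma$ avoids both $231$ and $1432$ and $\sigma^2$ avoids $231$.
   Context: $\mathcal{S}_n$ is the set of permutations of $[n]$, written as words with $\pi_i=\pi(i)$; $\pi^2=\pi\circ\pi$. A permutation contains a pattern $\sigma\in\mathcal{S}_k$ if some (not necessarily consecutive) subsequence of length $k$ is order isomorphic to $\sigma$; otherwise it avoids it. For $\sigma\in\mathcal{S}_k$, $\tau\in\mathcal{S}_m$, the direct sum $\sigma\oplus\tau\in\mathcal{S}_{k+m}$ is defined by $(\sigma\oplus\tau)(i)=\sigma(i)$ for $1\le i\le k$ and $(\sigma\oplus\tau)(i)=\tau(i-k)+k$ for $k+1\le i\le k+m$. -}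

module Defs where

open import Data.Nat using (ℕ; suc; _+_)
open import Data.Sum using ([_,_]′)
open import Data.Fin using (Fin; zero; suc; _<_; _↑ˡ_; _↑ʳ_; splitAt)
open import Data.Fin.Permutation using (Permutation′; permutation; _⟨$⟩ʳ_; _∘ₚ_; id)
open import Data.Product using (Σ; _×_)
open import Data.Empty using (⊥)
open import Relation.Binary.PropositionalEquality using (_≡_; refl)
open import Function.Bundles using (_⇔_)

-- Convention: [n] is represented by Fin n (0-based, order preserved: i ↦ i+1).
-- π ∈ S_n is a Permutation′ n (a bijection Fin n ↔ Fin n); π_i = π ⟨$⟩ʳ i.

Contains : ∀ {n k} → Permutation′ n → Permutation′ k → Set
Contains {n} {k} π σ =
  Σ (Fin k → Fin n) λ e →
    (∀ i j → i < j → e i < e j) ×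
    (∀ i j → ((π ⟨$⟩ʳ e i) < (π ⟨$⟩ʳ e j)) ⇔ ((σ ⟨$⟩ʳ i) < (σ ⟨$⟩ʳ j)))

Avoids : ∀ {n k} → Permutation′ n → Permutation′ k → Set
Avoids π σ = Contains π σ → ⊥

sq : ∀ {n} → Permutation′ n → Permutation′ n
sq π = π ∘ₚ π

p231 : Permutation′ 3
p231 = permutation f g fg gf
  where
  f g : Fin 3 → Fin 3
  f zero = suc zero
  f (suc zero) = suc (suc zero)
  f (suc (suc zero)) = zero
  g zero = suc (suc zero)
  g (suc zero) = zero
  g (suc (suc zero)) = suc zero
  fg : ∀ x → f (g x) ≡ x
  fg zero = refl
  fg (suc zero) = refl
  fg (suc (suc zero)) = refl
  gf : ∀ x → g (f x) ≡ x
  gf zero = refl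
  gf (suc zero) = refl
  gf (suc (suc zero)) = refl

p1432 : Permutation′ 4
p1432 = permutation f f ff ff
  where
  f : Fin 4 → Fin 4
  f zero = zero
  f (suc zero) = suc (suc (suc zero))
  f (suc (suc zero)) = suc (suc zero)
  f (suc (suc (suc zero))) = suc zero
  ff : ∀ x → f (f x) ≡ x
  ff zero = refl
  ff (suc zero) = refl
  ff (suc (suc zero)) = refl
  ff (suc (suc (suc zero))) = refl

_⊕_ : ∀ {k m} → Permutation′ k → Permutation′ m → Fin (k + m) → Fin (k + m)
_⊕_ {k} {m} σ τ i = [ (λ a → (σ ⟨$⟩ʳ a) ↑ˡ m) , (λ b → k ↑ʳ (τ ⟨$⟩ʳ b)) ]′ (splitAt k i)

one : Permutation′ 1
one = id

module Submission where

-- π = σ ⊕ 1 says exactly that π fixes its last position, and then π² = σ² ⊕ 1.  Any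
-- occurrence of a pattern in σ shifts to one in σ ⊕ 1.  Conversely, 231 and 1432 do not end
-- with their largest entry, while the last entry of σ ⊕ 1 exceeds all others; so an
-- occurrence in σ ⊕ 1 never uses the last position and is already an occurrence in σ.

open import Defs
open import Data.Nat using (ℕ; _+_; _≤_)
open import Data.Fin using (Fin; zero; _↑ʳ_)
open import Data.Fin.Permutation using (Permutation′; _⟨$⟩ʳ_)
open import Data.Product using (Σ; _×_)
open import Relation.Binary.PropositionalEquality using (_≡_)
open import Function.Bundles using (_⇔_)

open import Data.Nat as ℕ using (suc; z≤n; s≤s)
import Data.Nat.Properties as ℕ
open import Data.Fin as Fin using (toℕ; fromℕ; _↑ˡ_; splitAt)
open import Data.Fin.Properties
  using (toℕ-injective; toℕ-↑ˡ; toℕ-↑ʳ; toℕ<n; ↑ˡ-injective; splitAt-↑ˡ; splitAt-↑ʳ;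
         splitAt⁻¹-↑ˡ; splitAt⁻¹-↑ʳ; ≤fromℕ; ≤∧≢⇒<; <⇒≢; <-irrefl; <-asym)
open import Data.Fin.Permutation using (permutation; _⟨$⟩ˡ_; _∘ₚ_; inverseˡ; inverseʳ; flip)
open import Data.Product using (_,_; proj₁; proj₂; ∃)
open import Data.Sum using (inj₁; inj₂)
open import Data.Empty using (⊥-elim)
open import Function using (id; _∘_; _∘′_)
open import Function.Bundles using (mk⇔; Equivalence)
import Function.Properties.Equivalence as ⇔
open import Relation.Binary.PropositionalEquality
  using (refl; sym; trans; cong; subst; subst₂; _≗_; _≢_; module ≡-Reasoning)

private
  variable
    k m n : ℕ

Occurrence : Permutation′ n → Permutation′ k → (Fin k → Fin n) → Set
Occurrence π ρ e =
  (∀ i j → i Fin.< j → e i Fin.< e j) ×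
  (∀ i j → ((π ⟨$⟩ʳ e i) Fin.< (π ⟨$⟩ʳ e j)) ⇔ ((ρ ⟨$⟩ʳ i) Fin.< (ρ ⟨$⟩ʳ j)))

strict-mono⇒mono : {e : Fin k → Fin n} → (∀ i j → i Fin.< j → e i Fin.< e j) →
                   ∀ {i j} → i Fin.≤ j → e i Fin.≤ e j
strict-mono⇒mono {e = e} mono {i} {j} i≤j with ℕ.m≤n⇒m<n∨m≡n i≤j
... | inj₁ i<j = ℕ.<⇒≤ (mono i j i<j)
... | inj₂ i≡j = ℕ.≤-reflexive (cong (toℕ ∘ e) (toℕ-injective i≡j))

↑ˡ-<-⇔ : ∀ n (i j : Fin m) → ((i ↑ˡ n) Fin.< (j ↑ˡ n)) ⇔ (i Fin.< j)
↑ˡ-<-⇔ n i j rewrite toℕ-↑ˡ i n | toℕ-↑ˡ j n = mk⇔ id id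

data SplitView k {n} : Fin (k + n) → Set where
  left  : (i : Fin k) → SplitView k (i ↑ˡ n)
  right : (j : Fin n) → SplitView k (k ↑ʳ j)

splitView : ∀ k {n} (x : Fin (k + n)) → SplitView k x
splitView k x with splitAt k x in eq
... | inj₁ i = subst (SplitView k) (splitAt⁻¹-↑ˡ eq) (left i)
... | inj₂ j = subst (SplitView k) (splitAt⁻¹-↑ʳ eq) (right j)

⊕-↑ˡ : (σ : Permutation′ k) (τ : Permutation′ n) (i : Fin k) →
       (σ ⊕ τ) (i ↑ˡ n) ≡ (σ ⟨$⟩ʳ i) ↑ˡ n
⊕-↑ˡ {k} {n} σ τ i rewrite splitAt-↑ˡ k i n = refl

⊕-↑ʳ : (σ : Permutation′ k) (τ : Permutation′ n) (j : Fin n) →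
       (σ ⊕ τ) (k ↑ʳ j) ≡ k ↑ʳ (τ ⟨$⟩ʳ j)
⊕-↑ʳ {k} {n} σ τ j rewrite splitAt-↑ʳ k n j = refl

∘ₚ-⊕ : (π π′ : Permutation′ (k + n)) (σ σ′ : Permutation′ k) (τ τ′ : Permutation′ n) →
       (π ⟨$⟩ʳ_) ≗ σ ⊕ τ → (π′ ⟨$⟩ʳ_) ≗ σ′ ⊕ τ′ →
       ((π ∘ₚ π′) ⟨$⟩ʳ_) ≗ (σ ∘ₚ σ′) ⊕ (τ ∘ₚ τ′)
∘ₚ-⊕ {k} {n} π π′ σ σ′ τ τ′ π≗ π′≗ x with splitView k x
... | left i = begin
  π′ ⟨$⟩ʳ (π ⟨$⟩ʳ (i ↑ˡ n))       ≡⟨ cong (π′ ⟨$⟩ʳ_) (trans (π≗ _) (⊕-↑ˡ σ τ i)) ⟩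
  π′ ⟨$⟩ʳ ((σ ⟨$⟩ʳ i) ↑ˡ n)        ≡⟨ trans (π′≗ _) (⊕-↑ˡ σ′ τ′ _) ⟩
  ((σ ∘ₚ σ′) ⟨$⟩ʳ i) ↑ˡ n          ≡⟨ ⊕-↑ˡ (σ ∘ₚ σ′) (τ ∘ₚ τ′) i ⟨
  ((σ ∘ₚ σ′) ⊕ (τ ∘ₚ τ′)) (i ↑ˡ n) ∎
  where open ≡-Reasoning
... | right j = begin
  π′ ⟨$⟩ʳ (π ⟨$⟩ʳ (k ↑ʳ j))       ≡⟨ cong (π′ ⟨$⟩ʳ_) (trans (π≗ _) (⊕-↑ʳ σ τ j)) ⟩
  π′ ⟨$⟩ʳ (k ↑ʳ (τ ⟨$⟩ʳ j))        ≡⟨ trans (π′≗ _) (⊕-↑ʳ σ′ τ′ _) ⟩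
  k ↑ʳ ((τ ∘ₚ τ′) ⟨$⟩ʳ j)          ≡⟨ ⊕-↑ʳ (σ ∘ₚ σ′) (τ ∘ₚ τ′) j ⟨
  ((σ ∘ₚ σ′) ⊕ (τ ∘ₚ τ′)) (k ↑ʳ j) ∎
  where open ≡-Reasoning

sq-⊕-one : (π : Permutation′ (m + 1)) (σ : Permutation′ m) →
           (π ⟨$⟩ʳ_) ≗ σ ⊕ one → (sq π ⟨$⟩ʳ_) ≗ sq σ ⊕ one
sq-⊕-one π σ π≗ = ∘ₚ-⊕ π π σ σ one one π≗ π≗

module _ (π : Permutation′ (m + n)) (σ : Permutation′ m) (τ : Permutation′ n)
         (π≗ : (π ⟨$⟩ʳ_) ≗ σ ⊕ τ) (ρ : Permutation′ k) where

  Occurrence-↑ˡ : (e : Fin k → Fin (m + n)) (e′ : Fin k → Fin m) → (∀ i → e i ≡ e′ i ↑ˡ n) →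
                  Occurrence π ρ e ⇔ Occurrence σ ρ e′
  Occurrence-↑ˡ e e′ e≗ = mk⇔
    (λ (mono , iff) → (λ i j → to (positions i j) ∘ mono i j) ,
                      (λ i j → ⇔.trans (⇔.sym (values i j)) (iff i j)))
    (λ (mono , iff) → (λ i j → from (positions i j) ∘ mono i j) ,
                      (λ i j → ⇔.trans (values i j) (iff i j)))
    where
    open Equivalence
    positions : ∀ i j → (e i Fin.< e j) ⇔ (e′ i Fin.< e′ j)
    positions i j rewrite e≗ i | e≗ j = ↑ˡ-<-⇔ n (e′ i) (e′ j)
    values : ∀ i j → ((π ⟨$⟩ʳ e i) Fin.< (π ⟨$⟩ʳ e j)) ⇔ ((σ ⟨$⟩ʳ e′ i) Fin.< (σ ⟨$⟩ʳ e′ j))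
    values i j rewrite e≗ i | e≗ j | π≗ (e′ i ↑ˡ n) | π≗ (e′ j ↑ˡ n)
                     | ⊕-↑ˡ σ τ (e′ i) | ⊕-↑ˡ σ τ (e′ j) = ↑ˡ-<-⇔ n _ _

  Contains-⊕ˡ : Contains σ ρ → Contains π ρ
  Contains-⊕ˡ (e′ , occ) = (_↑ˡ n) ∘ e′ , Equivalence.from (Occurrence-↑ˡ _ e′ (λ _ → refl)) occ

module _ {m : ℕ} where

  last : Fin (m + 1)
  last = m ↑ʳ zero

  ↑ˡ<last : (y : Fin m) → (y ↑ˡ 1) Fin.< last
  ↑ˡ<last y = subst₂ ℕ._<_ (sym (toℕ-↑ˡ y 1))
                (sym (trans (toℕ-↑ʳ m zero) (ℕ.+-identityʳ m))) (toℕ<n y)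

  ≤last : (x : Fin (m + 1)) → x Fin.≤ last
  ≤last x with splitView m x
  ... | left y     = ℕ.<⇒≤ (↑ˡ<last y)
  ... | right zero = ℕ.≤-refl

  <last⇒↑ˡ : {x : Fin (m + 1)} → x Fin.< last → ∃ λ y → x ≡ y ↑ˡ 1
  <last⇒↑ˡ {x} x<last with splitView m x
  ... | left y     = y , refl
  ... | right zero = ⊥-elim (<-irrefl refl x<last)

  fixes-last⇒maps-↑ˡ : (ρ : Permutation′ (m + 1)) → ρ ⟨$⟩ʳ last ≡ last →
                       (y : Fin m) → ∃ λ z → ρ ⟨$⟩ʳ (y ↑ˡ 1) ≡ z ↑ˡ 1
  fixes-last⇒maps-↑ˡ ρ ρ-last y = <last⇒↑ˡ (≤∧≢⇒< (≤last _) ρy≢last)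
    where
    ρy≢last : ρ ⟨$⟩ʳ (y ↑ˡ 1) ≢ last
    ρy≢last eq = <⇒≢ (↑ˡ<last y) (begin
      y ↑ˡ 1                    ≡⟨ inverseˡ ρ ⟨
      ρ ⟨$⟩ˡ (ρ ⟨$⟩ʳ (y ↑ˡ 1))  ≡⟨ cong (ρ ⟨$⟩ˡ_) (trans eq (sym ρ-last)) ⟩
      ρ ⟨$⟩ˡ (ρ ⟨$⟩ʳ last)      ≡⟨ inverseˡ ρ ⟩
      last                      ∎)
      where open ≡-Reasoning

  fixes-last⇒⊕-one : (ρ : Permutation′ (m + 1)) → ρ ⟨$⟩ʳ last ≡ last →
                     Σ (Permutation′ m) λ σ → (ρ ⟨$⟩ʳ_) ≗ σ ⊕ one
  fixes-last⇒⊕-one ρ ρ-last = σ , ρ≗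
    where
    ρ⁻¹-last : ρ ⟨$⟩ˡ last ≡ last
    ρ⁻¹-last = trans (cong (ρ ⟨$⟩ˡ_) (sym ρ-last)) (inverseˡ ρ)

    f g : Fin m → Fin m
    f = proj₁ ∘ fixes-last⇒maps-↑ˡ ρ ρ-last
    g = proj₁ ∘ fixes-last⇒maps-↑ˡ (flip ρ) ρ⁻¹-last

    f-spec : ∀ y → ρ ⟨$⟩ʳ (y ↑ˡ 1) ≡ f y ↑ˡ 1
    f-spec = proj₂ ∘ fixes-last⇒maps-↑ˡ ρ ρ-last

    g-spec : ∀ y → ρ ⟨$⟩ˡ (y ↑ˡ 1) ≡ g y ↑ˡ 1
    g-spec = proj₂ ∘ fixes-last⇒maps-↑ˡ (flip ρ) ρ⁻¹-last

    f∘g : ∀ y → f (g y) ≡ y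
    f∘g y = ↑ˡ-injective 1 _ _ (begin
      f (g y) ↑ˡ 1              ≡⟨ f-spec (g y) ⟨
      ρ ⟨$⟩ʳ (g y ↑ˡ 1)         ≡⟨ cong (ρ ⟨$⟩ʳ_) (g-spec y) ⟨
      ρ ⟨$⟩ʳ (ρ ⟨$⟩ˡ (y ↑ˡ 1))  ≡⟨ inverseʳ ρ ⟩
      y ↑ˡ 1                    ∎)
      where open ≡-Reasoning

    g∘f : ∀ y → g (f y) ≡ y
    g∘f y = ↑ˡ-injective 1 _ _ (begin
      g (f y) ↑ˡ 1              ≡⟨ g-spec (f y) ⟨
      ρ ⟨$⟩ˡ (f y ↑ˡ 1)         ≡⟨ cong (ρ ⟨$⟩ˡ_) (f-spec y) ⟨
      ρ ⟨$⟩ˡ (ρ ⟨$⟩ʳ (y ↑ˡ 1))  ≡⟨ inverseˡ ρ ⟩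
      y ↑ˡ 1                    ∎)
      where open ≡-Reasoning

    σ : Permutation′ m
    σ = permutation f g f∘g g∘f

    ρ≗ : (ρ ⟨$⟩ʳ_) ≗ σ ⊕ one
    ρ≗ x with splitView m x
    ... | left y     = trans (f-spec y) (sym (⊕-↑ˡ σ one y))
    ... | right zero = trans ρ-last (sym (⊕-↑ʳ σ one zero))

Contains-⊕-one⁻¹ : (π : Permutation′ (m + 1)) (σ : Permutation′ m) → (π ⟨$⟩ʳ_) ≗ σ ⊕ one →
                   (ρ : Permutation′ (suc k)) (a : Fin (suc k)) →
                   (ρ ⟨$⟩ʳ fromℕ k) Fin.< (ρ ⟨$⟩ʳ a) →
                   Contains π ρ → Contains σ ρ
Contains-⊕-one⁻¹ {m} {k} π σ π≗ ρ a ρl<ρa (e , occ@(mono , iff)) =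
  e′ , Equivalence.to (Occurrence-↑ˡ π σ one π≗ ρ e e′ (proj₂ ∘ below)) occ
  where
  l : Fin (suc k)
  l = fromℕ k

  a<l : a Fin.< l
  a<l = ≤∧≢⇒< (≤fromℕ a) λ a≡l → <-irrefl (cong (ρ ⟨$⟩ʳ_) (sym a≡l)) ρl<ρa

  el≢last : e l ≢ last
  el≢last el≡last with <last⇒↑ˡ (subst (e a Fin.<_) el≡last (mono a l a<l))
  ... | y , ea≡ = <-asym ρl<ρa (Equivalence.to (iff a l) (subst₂ Fin._<_ πea πel (↑ˡ<last (σ ⟨$⟩ʳ y))))
    where
    πea : (σ ⟨$⟩ʳ y) ↑ˡ 1 ≡ π ⟨$⟩ʳ e a
    πea = sym (trans (cong (π ⟨$⟩ʳ_) ea≡) (trans (π≗ _) (⊕-↑ˡ σ one y)))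
    πel : last ≡ π ⟨$⟩ʳ e l
    πel = sym (trans (cong (π ⟨$⟩ʳ_) el≡last) (trans (π≗ _) (⊕-↑ʳ σ one zero)))

  below : ∀ i → ∃ λ y → e i ≡ y ↑ˡ 1
  below i = <last⇒↑ˡ (ℕ.≤-<-trans (strict-mono⇒mono {e = e} mono (≤fromℕ i))
                                   (≤∧≢⇒< (≤last (e l)) el≢last))

  e′ : Fin (suc k) → Fin m
  e′ = proj₁ ∘ below

lemma2p4 : (m : ℕ) → 2 ≤ m → (π : Permutation′ (m + 1)) →
    (Avoids π p231 × Avoids π p1432 × Avoids (sq π) p231 ×
       (π ⟨$⟩ʳ (m ↑ʳ zero)) ≡ (m ↑ʳ zero))
    ⇔
    Σ (Permutation′ m) (λ σ →
       (∀ i → (π ⟨$⟩ʳ i) ≡ (σ ⊕ one) i) ×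
       Avoids σ p231 × Avoids σ p1432 × Avoids (sq σ) p231)
lemma2p4 m _ π = mk⇔
  (λ (π-231 , π-1432 , π²-231 , π-last) →
    let σ , π≗ = fixes-last⇒⊕-one π π-last
        π²≗ = sq-⊕-one π σ π≗
    in σ , π≗ ,
       π-231 ∘′ Contains-⊕ˡ π σ one π≗ p231 ,
       π-1432 ∘′ Contains-⊕ˡ π σ one π≗ p1432 ,
       π²-231 ∘′ Contains-⊕ˡ (sq π) (sq σ) one π²≗ p231)
  (λ (σ , π≗ , σ-231 , σ-1432 , σ²-231) →
    σ-231 ∘′ Contains-⊕-one⁻¹ π σ π≗ p231 zero (s≤s z≤n) ,
    σ-1432 ∘′ Contains-⊕-one⁻¹ π σ π≗ p1432 (Fin.suc zero) (s≤s (s≤s z≤n)) ,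
    σ²-231 ∘′ Contains-⊕-one⁻¹ (sq π) (sq σ) (sq-⊕-one π σ π≗) p231 zero (s≤s z≤n) ,
    trans (π≗ last) (⊕-↑ʳ σ one zero))
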